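{- For any permutation $\pi$ and every $n\ge1$, $|\mathrm{Av}^{\mathrm{key}}_n(\pi)|=|\mathrm{Av}^{\mathrm{key}}_n(((\pi^{\mathrm{rev}})^{ -1})^{\mathrm{rev}})|$. More generally, for any set $S$ of permutations, $|\mathrm{Av}^{\mathrm{key}}_n(S)|=|\mathrm{Av}^{\mathrm{key}}_n(S')|$ for every $n$, where $S'=\{((\pi^{\mathrm{rev}})^{ -1})^{\mathrm{rev}}:\pi\in S\}$.
   Context: An alternating sign matrix (ASM) of size $n$ is an $n\times n$ matrix with entries in $\{0,1,-1\}$ such that every row and every column sums to $1$ and the nonzero entries of each row and of each column alternate in sign. Position $(i,j)$ is the $i$-th row from the top and $j$-th column from the left. The permutation matrix of $\sigma=\sigma(1)\dots\sigma(n)$ has a $1$ in row $i$, column $\sigma(i)$ for each $i$. A permutation $\sigma$ contains $\pi=\pi(1)\dots\pi(k)$ if there are indices $i_1<\dots<i_k$ with $\sigma(i_a)<\sigma(i_b)$ iff $\pi(a)<\pi(b)$; otherwise $\sigma$ avoids $\pi$. $\pi^{\mathrm{rev}}$ is the reverse of $\pi$ (one-line notation read right to left) and $\pi^{ -1}$ the inverse permutation. SW key process: a $-1$ entry is removable if no other $-1$ entry lies weakly southwest of it. For a removable $-1$ at $(i,j)$, let $(i,j_0)$ be the nearest $1$ to its west in its row and $(i_0,j)$ the nearest $1$ below it in its column; its neighboring $1$s are the $1$ entries weakly southwest of it such that no other $1$ entry lies both weakly northeast of them and weakly southwest of the $-1$. Consider the $1$s at $(i,j_0)$, $(i_0,j)$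 and the neighboring $1$s lying in the rectangle of rows $i..i_0$ and columns $j_0..j$. Replace the south-most of these $1$s by $0$; then moving east to west, for each subsequent one of these $1$s, in column $c$ say, place a new $1$ in the row of the previously replaced $1$ and column $c$, and replace the old $1$ in column $c$ by $0$; finally replace the $-1$ by $0$. Repeating until no $-1$ remains yields a permutation matrix (the SW key of $A$), independent of the order of removals. $\mathrm{Av}^{\mathrm{key}}_n(S)$ denotes the set of $n\times n$ ASMs whose SW key avoids every pattern in $S$. -}

module Defs where

open import Data.Nat using (ℕ; suc)
open import Data.Fin using (Fin; _<_; _≤_; opposite; _≟_)
open import Data.Integer using (ℤ; _+_; 0ℤ; 1ℤ; -1ℤ)
open import Data.Vec using (Vec; lookup; tabulate; foldr′)
open import Data.Product using (Σ; ∃; ∃-syntax; _×_; _,_)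
open import Data.Sum using (_⊎_)
open import Relation.Nullary using (¬_; yes; no)
open import Relation.Binary.PropositionalEquality using (_≡_; _≢_)
open import Relation.Binary.Construct.Closure.ReflexiveTransitive using (Star)
open import Function.Bundles using (_⇔_)
open import Function.Definitions using (Injective)

-- Matrices: n×n integer matrices, row i (0-based, top = 0), column j
-- (0-based, left = 0).  South = larger row index, west = smaller column.

Mat : ℕ → Set
Mat n = Vec (Vec ℤ n) n

_⟨_,_⟩ : ∀ {n} → Mat n → Fin n → Fin n → ℤ
A ⟨ i , j ⟩ = lookup (lookup A i) j

sumℤ : ∀ {n} → Vec ℤ n → ℤ
sumℤ = foldr′ _+_ 0ℤ

IsEntry : ℤ → Set
IsEntry x = x ≡ 0ℤ ⊎ x ≡ 1ℤ ⊎ x ≡ -1ℤ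

Alternates : ∀ {n} → (Fin n → ℤ) → Set
Alternates {n} v =
  ∀ (q q′ : Fin n) → q < q′ → v q ≢ 0ℤ → v q′ ≢ 0ℤ →
  (∀ r → q < r → r < q′ → v r ≡ 0ℤ) → v q + v q′ ≡ 0ℤ

IsASM : ∀ {n} → Mat n → Set
IsASM {n} A =
  (∀ i j → IsEntry (A ⟨ i , j ⟩)) ×
  (∀ i → sumℤ (tabulate (λ j → A ⟨ i , j ⟩)) ≡ 1ℤ) ×
  (∀ j → sumℤ (tabulate (λ i → A ⟨ i , j ⟩)) ≡ 1ℤ) ×
  (∀ i → Alternates (λ j → A ⟨ i , j ⟩)) ×
  (∀ j → Alternates (λ i → A ⟨ i , j ⟩))

permMatrix : ∀ {n} → (Fin n → Fin n) → Mat n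
permMatrix σ = tabulate (λ i → tabulate (λ j → f (σ i ≟ j)))
  where
  f : ∀ {P : Set} → Relation.Nullary.Dec P → ℤ
  f (yes _) = 1ℤ
  f (no _)  = 0ℤ

rev : ∀ {k} → (Fin k → Fin k) → (Fin k → Fin k)
rev π i = π (opposite i)

IsInverse : ∀ {k} → (Fin k → Fin k) → (Fin k → Fin k) → Set
IsInverse μ ρ = ∀ i → (μ (ρ i) ≡ i) × (ρ (μ i) ≡ i)

Contains : ∀ {n k} → (Fin n → Fin n) → (Fin k → Fin k) → Set
Contains {n} {k} σ π =
  Σ (Fin k → Fin n) λ ι →
    (∀ a b → a < b → ι a < ι b) ×
    (∀ a b → (σ (ι a) < σ (ι b)) ⇔ (π a < π b))

PermSet : Set₁
PermSet = (k : ℕ) → (Fin k → Fin k) → Set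

IsSetOfPerms : PermSet → Set
IsSetOfPerms S = ∀ k π → S k π → Injective _≡_ _≡_ π

AvoidsAll : ∀ {n} → (Fin n → Fin n) → PermSet → Set
AvoidsAll σ S = ∀ k π → S k π → ¬ Contains σ π

transformSet : PermSet → PermSet
transformSet S k τ =
  ∃[ π ] S k π × ∃[ μ ] IsInverse μ (rev π) × (∀ i → τ i ≡ rev μ i)

WSW : ∀ {n} → Fin n → Fin n → Fin n → Fin n → Set
WSW p q i j = (i ≤ p) × (q ≤ j)

Removable : ∀ {n} → Mat n → Fin n → Fin n → Set
Removable A i j =
  (A ⟨ i , j ⟩ ≡ -1ℤ) ×
  (∀ p q → WSW p q i j → ¬ (p ≡ i × q ≡ j) → A ⟨ p , q ⟩ ≢ -1ℤ)

WestOne : ∀ {n} → Mat n → Fin n → Fin n → Fin n → Set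
WestOne A i j j₀ =
  (j₀ < j) × (A ⟨ i , j₀ ⟩ ≡ 1ℤ) × (∀ q → j₀ < q → q < j → A ⟨ i , q ⟩ ≢ 1ℤ)

SouthOne : ∀ {n} → Mat n → Fin n → Fin n → Fin n → Set
SouthOne A i j i₀ =
  (i < i₀) × (A ⟨ i₀ , j ⟩ ≡ 1ℤ) × (∀ p → i < p → p < i₀ → A ⟨ p , j ⟩ ≢ 1ℤ)

Neighbor : ∀ {n} → Mat n → Fin n → Fin n → Fin n → Fin n → Set
Neighbor A i j p q =
  (A ⟨ p , q ⟩ ≡ 1ℤ) × WSW p q i j ×
  (∀ p′ q′ → A ⟨ p′ , q′ ⟩ ≡ 1ℤ → WSW p q p′ q′ → WSW p′ q′ i j →
     (p′ ≡ p × q′ ≡ q))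

Involved : ∀ {n} → Mat n → (i j j₀ i₀ : Fin n) → Fin n → Fin n → Set
Involved A i j j₀ i₀ p q =
  (p ≡ i × q ≡ j₀) ⊎ (p ≡ i₀ × q ≡ j) ⊎
  (Neighbor A i j p q × (i ≤ p) × (p ≤ i₀) × (j₀ ≤ q) × (q ≤ j))

-- a new 1 is placed at (p , q) when the involved 1 in column q is moved
-- to the row p of the previously replaced involved 1, i.e. the involved 1
-- immediately to the east of column q
NewOne : ∀ {n} → Mat n → (i j j₀ i₀ : Fin n) → Fin n → Fin n → Set
NewOne A i j j₀ i₀ p q =
  (∃[ p₁ ] Involved A i j j₀ i₀ p₁ q) ×
  ∃[ q₂ ] (Involved A i j j₀ i₀ p q₂ × (q < q₂) ×
           (∀ r c → Involved A i j j₀ i₀ r c → ¬ ((q < c) × (c < q₂))))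

StepAt : ∀ {n} → Mat n → Fin n → Fin n → Mat n → Set
StepAt A i j B =
  Removable A i j × ∃[ j₀ ] ∃[ i₀ ] (WestOne A i j j₀ × SouthOne A i j i₀ ×
    (∀ p q →
      (((p ≡ i × q ≡ j) ⊎ Involved A i j j₀ i₀ p q) → B ⟨ p , q ⟩ ≡ 0ℤ) ×
      (NewOne A i j j₀ i₀ p q → B ⟨ p , q ⟩ ≡ 1ℤ) ×
      (¬ ((p ≡ i × q ≡ j) ⊎ Involved A i j j₀ i₀ p q ⊎ NewOne A i j j₀ i₀ p q) →
         B ⟨ p , q ⟩ ≡ A ⟨ p , q ⟩)))

Step : ∀ {n} → Mat n → Mat n → Set
Step A B = ∃[ i ] ∃[ j ] StepAt A i j B

SWKey : ∀ {n} → Mat n → (Fin n → Fin n) → Set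
SWKey A σ = Star Step A (permMatrix σ)

AvKey : ∀ {n} → ((Fin n → Fin n) → Set) → Mat n → Set
AvKey P A = IsASM A × ∃[ σ ] (SWKey A σ × P σ)

-- |{A : P A}| = |{A : Q A}|, for predicates on the finite type Mat n
-- (with decidable equality): there is a bijection between them.
SameCard : ∀ {n} → (Mat n → Set) → (Mat n → Set) → Set
SameCard {n} P Q =
  Σ (Mat n → Mat n) λ f → Σ (Mat n → Mat n) λ g →
    (∀ A → P A → Q (f A)) × (∀ B → Q B → P (g B)) ×
    (∀ A → P A → g (f A) ≡ A) × (∀ B → Q B → f (g B) ≡ B)

{-# OPTIONS --safe #-}
module Submission where

-- Reflection in the anti-diagonal, (p , q) ↦ (n-1-q , n-1-p), is an involution on ASMs that
-- maps the quadrant weakly southwest of an entry onto the quadrant weakly southwest of its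
-- image, so it carries each removal step of the SW key process to a removal step: the SW key of
-- the reflected matrix is the reflected key. On permutation matrices the reflection sends σ to
-- ((σ^rev)⁻¹)^rev, and it maps occurrences of π in σ to occurrences of ((π^rev)⁻¹)^rev in
-- ((σ^rev)⁻¹)^rev. Hence it restricts to a bijection from Av^key_n(S) to Av^key_n(S′).
-- For the reflected key to be a permutation the key must be surjective: removal steps keep
-- every column summing to 1 with a -1 between any two 1s, so every column of the final
-- permutation matrix contains a 1.

open import Defs
open import Data.Nat using (ℕ; _≥_)
open import Data.Fin using (Fin)
open import Data.Product using (_×_)
open import Relation.Nullary using (¬_)
open import Relation.Binary.PropositionalEquality using (_≡_)
open import Function.Definitions using (Injective)

open import Data.Fin using (zero; suc; opposite; _<_; _≤_; _≟_; _<?_; punchIn; punchOut)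
import Data.Fin.Permutation as Permutation
import Data.Fin.Properties as Fin
open import Data.Integer using (ℤ; 0ℤ; 1ℤ; -1ℤ; _+_)
import Data.Integer.Properties as ℤ
open import Algebra.Properties.CommutativeMonoid.Sum ℤ.+-0-commutativeMonoid
  using (sum; sum-permute; sum-remove; sum-cong-≗; sum-replicate-zero)
open import Data.Nat using (zero; suc; s≤s)
import Data.Nat.Properties as ℕ
open import Data.Product using (∃; _,_; proj₁; proj₂)
open import Data.Sum using (_⊎_; inj₁; inj₂)
open import Data.Vec using (Vec; lookup; tabulate)
open import Data.Vec.Functional using (removeAt)
open import Data.Vec.Properties using (lookup∘tabulate; tabulate-cong; tabulate∘lookup)
open import Function using (_∘_; _∋_)
open import Function.Bundles using (_⇔_; mk⇔; Equivalence)
open import Relation.Binary using (tri<; tri≈; tri>)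
open import Relation.Binary.Construct.Closure.ReflexiveTransitive using (Star; ε; _◅_; gmap)
open import Relation.Binary.PropositionalEquality
  using (_≢_; refl; sym; trans; cong; cong₂; subst; subst₂; module ≡-Reasoning)
open import Relation.Nullary using (Dec; yes; no; contradiction)
open import Relation.Nullary.Decidable using (_×-dec_; _⊎-dec_; _→-dec_; ¬?)
open import Relation.Unary using (Pred; Decidable)

open Equivalence using (to; from)

private variable
  n : ℕ

opposite-< : {i j : Fin n} → i < j → opposite j < opposite i
opposite-< {n} {i} {j} i<j rewrite Fin.opposite-prop i | Fin.opposite-prop j =
  ℕ.∸-monoʳ-< (s≤s i<j) (Fin.toℕ<n j)

opposite-≤ : {i j : Fin n} → i ≤ j → opposite j ≤ opposite i
opposite-≤ {n} {i} {j} i≤j rewrite Fin.opposite-prop i | Fin.opposite-prop j =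
  ℕ.∸-monoʳ-≤ n (s≤s i≤j)

opposite-<-reflect : {i j : Fin n} → opposite j < opposite i → i < j
opposite-<-reflect {i = i} {j} h =
  subst₂ _<_ (Fin.opposite-involutive i) (Fin.opposite-involutive j) (opposite-< h)

opposite-<-swapʳ : {i j : Fin n} → i < opposite j → j < opposite i
opposite-<-swapʳ {i = i} {j} h =
  subst (_< opposite i) (Fin.opposite-involutive j) (opposite-< h)

opposite-<-swapˡ : {i j : Fin n} → opposite i < j → opposite j < i
opposite-<-swapˡ {i = i} {j} h =
  subst (opposite j <_) (Fin.opposite-involutive i) (opposite-< h)

opposite-≤-swapʳ : {i j : Fin n} → i ≤ opposite j → j ≤ opposite i
opposite-≤-swapʳ {i = i} {j} h =
  subst (_≤ opposite i) (Fin.opposite-involutive j) (opposite-≤ h)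

opposite-≤-swapˡ : {i j : Fin n} → opposite i ≤ j → opposite j ≤ i
opposite-≤-swapˡ {i = i} {j} h =
  subst (opposite j ≤_) (Fin.opposite-involutive i) (opposite-≤ h)

opposite-swap : {i j : Fin n} → opposite i ≡ j → i ≡ opposite j
opposite-swap {i = i} refl = sym (Fin.opposite-involutive i)

cancel-opposite₄ : (G : Fin n → Fin n → Fin n → Fin n → Set) {a b c d : Fin n} →
  G (opposite (opposite a)) (opposite (opposite b)) (opposite (opposite c)) (opposite (opposite d)) →
  G a b c d
cancel-opposite₄ G {a} {b} {c} {d} = substs (Fin.opposite-involutive a) (Fin.opposite-involutive b)
                                            (Fin.opposite-involutive c) (Fin.opposite-involutive d)
  where
  substs : ∀ {a′ b′ c′ d′} → a′ ≡ a → b′ ≡ b → c′ ≡ c → d′ ≡ d → G a′ b′ c′ d′ → G a b c d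
  substs refl refl refl refl x = x

≤⇒<⊎≡ : {i j : Fin n} → i ≤ j → i < j ⊎ i ≡ j
≤⇒<⊎≡ {i = i} {j} i≤j with i ≟ j
... | yes i≡j = inj₂ i≡j
... | no i≢j  = inj₁ (Fin.≤∧≢⇒< i≤j i≢j)

∃-least : ∀ {ℓ} (P : Pred (Fin n) ℓ) → Decidable P → ∀ x → P x →
          ∃ λ m → P m × (∀ y → y < m → ¬ P y)
∃-least {suc n} P P? x Px with P? zero
... | yes P0 = zero , P0 , λ _ ()
... | no ¬P0 with x
...   | zero = contradiction Px ¬P0
...   | suc x′ with ∃-least (P ∘ suc) (P? ∘ suc) x′ Px
...     | m , Pm , below-m = suc m , Pm , below-suc-m
  where
  below-suc-m : ∀ y → y < suc m → ¬ P y
  below-suc-m zero    _         = ¬P0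
  below-suc-m (suc y) (s≤s y<m) = below-m y y<m

-1≢1 : -1ℤ ≢ 1ℤ
-1≢1 ()

1≢0 : 1ℤ ≢ 0ℤ
1≢0 ()

-1≢0 : -1ℤ ≢ 0ℤ
-1≢0 ()

sumℤ-tabulate : (f : Fin n → ℤ) → sumℤ (tabulate f) ≡ sum f
sumℤ-tabulate {zero}  f = refl
sumℤ-tabulate {suc n} f = cong (f zero +_) (sumℤ-tabulate (f ∘ suc))

sum-opposite : (f : Fin n → ℤ) → sum (f ∘ opposite) ≡ sum f
sum-opposite f = sym (sum-permute f Permutation.reverse)

sumℤ-reverse : {u v : Fin n → ℤ} → (∀ x → u x ≡ v (opposite x)) →
               sumℤ (tabulate u) ≡ sumℤ (tabulate v)
sumℤ-reverse {u = u} {v} u≗v∘opposite = begin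
  sumℤ (tabulate u)   ≡⟨ sumℤ-tabulate u ⟩
  sum u               ≡⟨ sum-cong-≗ u≗v∘opposite ⟩
  sum (v ∘ opposite)  ≡⟨ sum-opposite v ⟩
  sum v               ≡⟨ sumℤ-tabulate v ⟨
  sumℤ (tabulate v)   ∎
  where open ≡-Reasoning

sum-remove₂ : ∀ {n} {i j : Fin (suc (suc n))} (i≢j : i ≢ j) (t : Fin (suc (suc n)) → ℤ) →
              sum t ≡ t i + t j + sum (removeAt (removeAt t i) (punchOut i≢j))
sum-remove₂ {i = i} {j} i≢j t = begin
  sum t                                     ≡⟨ sum-remove t ⟩
  t i + sum (removeAt t i)                  ≡⟨ cong (t i +_) (sum-remove (removeAt t i)) ⟩
  t i + (t (punchIn i (punchOut i≢j)) + R)  ≡⟨ cong (λ x → t i + (t x + R)) (Fin.punchIn-punchOut i≢j) ⟩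
  t i + (t j + R)                           ≡⟨ ℤ.+-assoc (t i) (t j) R ⟨
  t i + t j + R                             ∎
  where
  open ≡-Reasoning
  R : ℤ
  R = sum (removeAt (removeAt t i) (punchOut i≢j))

sum-cong-outside₂ : {a b : Fin n} {w u : Fin n → ℤ} → a ≢ b → (∀ p → p ≢ a → p ≢ b → w p ≡ u p) →
                    w a + w b ≡ u a + u b → sum w ≡ sum u
sum-cong-outside₂ {suc zero}    {zero} {zero} a≢b = contradiction refl a≢b
sum-cong-outside₂ {suc (suc n)} {a} {b} {w} {u} a≢b agree balanced = begin
  sum w                     ≡⟨ sum-remove₂ a≢b w ⟩
  w a + w b + sum (rest w)  ≡⟨ cong₂ _+_ balanced (sum-cong-≗ λ k → agree _ (≢a k) (≢b k)) ⟩
  u a + u b + sum (rest u)  ≡⟨ sum-remove₂ a≢b u ⟨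
  sum u                     ∎
  where
  open ≡-Reasoning
  b′ : Fin (suc n)
  b′ = punchOut a≢b
  rest : (Fin (suc (suc n)) → ℤ) → Fin n → ℤ
  rest t = removeAt (removeAt t a) b′
  ≢a : ∀ k → punchIn a (punchIn b′ k) ≢ a
  ≢a k = Fin.punchInᵢ≢i a (punchIn b′ k)
  ≢b : ∀ k → punchIn a (punchIn b′ k) ≢ b
  ≢b k ≡b = Fin.punchInᵢ≢i b′ k
    (Fin.punchIn-injective a _ _ (trans ≡b (sym (Fin.punchIn-punchOut a≢b))))

-- Reflecting matrices in the anti-diagonal

lookup-tabulate² : (F : Fin n → Fin n → ℤ) (p q : Fin n) →
                   tabulate (λ p → tabulate (F p)) ⟨ p , q ⟩ ≡ F p q
lookup-tabulate² F p q =
  trans (cong (λ row → lookup row q) (lookup∘tabulate _ p)) (lookup∘tabulate _ q)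

vec-ext : {A : Set} {u v : Vec A n} → (∀ i → lookup u i ≡ lookup v i) → u ≡ v
vec-ext {u = u} {v} h =
  trans (sym (tabulate∘lookup u)) (trans (tabulate-cong h) (tabulate∘lookup v))

mat-ext : {A B : Mat n} → (∀ p q → A ⟨ p , q ⟩ ≡ B ⟨ p , q ⟩) → A ≡ B
mat-ext h = vec-ext λ p → vec-ext (h p)

record AntiTranspose (A A′ : Mat n) : Set where
  constructor antiTransposed
  field
    entry : ∀ p q → A′ ⟨ p , q ⟩ ≡ A ⟨ opposite q , opposite p ⟩

open AntiTranspose

antiTranspose : Mat n → Mat n
antiTranspose A = tabulate λ p → tabulate λ q → A ⟨ opposite q , opposite p ⟩

antiTranspose-spec : (A : Mat n) → AntiTranspose A (antiTranspose A)
antiTranspose-spec A = antiTransposed (lookup-tabulate² (λ p q → A ⟨ opposite q , opposite p ⟩))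

AntiTranspose-sym : {A A′ : Mat n} → AntiTranspose A A′ → AntiTranspose A′ A
AntiTranspose-sym {A = A} h = antiTransposed λ p q → sym (trans (entry h (opposite q) (opposite p))
  (cong₂ (λ x y → A ⟨ x , y ⟩) (Fin.opposite-involutive p) (Fin.opposite-involutive q)))

AntiTranspose-unique : {A A′ A″ : Mat n} → AntiTranspose A A′ → AntiTranspose A A″ → A′ ≡ A″
AntiTranspose-unique h h′ = mat-ext λ p q → trans (entry h p q) (sym (entry h′ p q))

antiTranspose-involutive : (A : Mat n) → antiTranspose (antiTranspose A) ≡ A
antiTranspose-involutive A = AntiTranspose-unique
  (antiTranspose-spec (antiTranspose A)) (AntiTranspose-sym (antiTranspose-spec A))

module _ {A A′ : Mat n} (h : AntiTranspose A A′) where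

  entry-opposite₂ : ∀ p q → A′ ⟨ opposite q , opposite p ⟩ ≡ A ⟨ p , q ⟩
  entry-opposite₂ p q = sym (entry (AntiTranspose-sym h) p q)

  entry-oppositeˡ : ∀ p q → A′ ⟨ opposite q , p ⟩ ≡ A ⟨ opposite p , q ⟩
  entry-oppositeˡ p q = trans (entry h (opposite q) p)
    (cong (λ x → A ⟨ opposite p , x ⟩) (Fin.opposite-involutive q))

  entry-oppositeʳ : ∀ p q → A′ ⟨ p , opposite q ⟩ ≡ A ⟨ q , opposite p ⟩
  entry-oppositeʳ p q = trans (entry h p (opposite q))
    (cong (λ x → A ⟨ x , opposite p ⟩) (Fin.opposite-involutive q))

Alternates-reverse : {u v : Fin n → ℤ} → (∀ x → u x ≡ v (opposite x)) → Alternates v → Alternates u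
Alternates-reverse {u = u} {v} u≗v∘opposite v-alternates q q′ q<q′ uq≢0 uq′≢0 u-zero-between = begin
  u q + u q′                        ≡⟨ ℤ.+-comm (u q) (u q′) ⟩
  u q′ + u q                        ≡⟨ cong₂ _+_ (u≗v∘opposite q′) (u≗v∘opposite q) ⟩
  v (opposite q′) + v (opposite q)  ≡⟨ v-alternates (opposite q′) (opposite q) (opposite-< q<q′)
                                         (uq′≢0 ∘ trans (u≗v∘opposite q′))
                                         (uq≢0 ∘ trans (u≗v∘opposite q)) v-zero-between ⟩
  0ℤ                                ∎
  where
  open ≡-Reasoning
  v-zero-between : ∀ r → opposite q′ < r → r < opposite q → v r ≡ 0ℤ
  v-zero-between r q̅′<r r<q̅ =
    trans (sym (trans (u≗v∘opposite (opposite r)) (cong v (Fin.opposite-involutive r))))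
      (u-zero-between (opposite r) (opposite-<-swapʳ r<q̅) (opposite-<-swapˡ q̅′<r))

IsASM-antiTranspose : {A : Mat n} → IsASM A → IsASM (antiTranspose A)
IsASM-antiTranspose {A = A} (entries , rows , columns , rows-alternate , columns-alternate) =
  (λ P Q → subst IsEntry (sym (entry A′ P Q)) (entries (opposite Q) (opposite P))) ,
  (λ P → trans (sumℤ-reverse (entry A′ P)) (columns (opposite P))) ,
  (λ Q → trans (sumℤ-reverse (λ P → entry A′ P Q)) (rows (opposite Q))) ,
  (λ P → Alternates-reverse (entry A′ P) (columns-alternate (opposite P))) ,
  (λ Q → Alternates-reverse (λ P → entry A′ P Q) (rows-alternate (opposite Q)))
  where
  A′ : AntiTranspose A (antiTranspose A)
  A′ = antiTranspose-spec A

-- Reflecting permutations in the anti-diagonal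

-- σ̂ = ((σ^rev)⁻¹)^rev: the graph of σ̂ is that of σ reflected in the anti-diagonal
record AntiReflection (σ σ̂ : Fin n → Fin n) : Set where
  constructor antiReflected
  field
    graph : ∀ p q → (σ̂ p ≡ q) ⇔ (σ (opposite q) ≡ opposite p)

open AntiReflection

AntiReflection-sym : {σ σ̂ : Fin n → Fin n} → AntiReflection σ σ̂ → AntiReflection σ̂ σ
AntiReflection-sym {σ = σ} R = antiReflected λ p q → mk⇔
  (λ σp≡q → from (graph R (opposite q) (opposite p))
    (trans (cong σ (Fin.opposite-involutive p)) (trans σp≡q (sym (Fin.opposite-involutive q)))))
  (λ σ̂q̅≡p̅ → trans (cong σ (sym (Fin.opposite-involutive p)))
    (trans (to (graph R (opposite q) (opposite p)) σ̂q̅≡p̅) (Fin.opposite-involutive q)))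

inverse⇒AntiReflection : {π μ τ : Fin n → Fin n} → IsInverse μ (rev π) → (∀ i → τ i ≡ rev μ i) →
                         AntiReflection π τ
inverse⇒AntiReflection {π = π} {μ} μ-inverse τ≗rev-μ = antiReflected λ p q → mk⇔
  (λ τp≡q → trans (cong (rev π) (trans (sym τp≡q) (τ≗rev-μ p))) (proj₂ (μ-inverse (opposite p))))
  (λ π-q̅≡p̅ → trans (τ≗rev-μ p) (trans (cong μ (sym π-q̅≡p̅)) (proj₁ (μ-inverse q))))

injective⇒surjective : (f : Fin n → Fin n) → Injective _≡_ _≡_ f → ∀ y → ∃ λ x → f x ≡ y
injective⇒surjective {suc m} f f-injective y with Fin.any? (λ x → f x ≟ y)
... | yes found = found
... | no ¬found = contradiction (Fin.injective⇒≤ g-injective) ℕ.1+n≰n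
  where
  g : Fin (suc m) → Fin m
  g x = punchOut {i = y} {j = f x} λ y≡fx → ¬found (x , sym y≡fx)
  g-injective : Injective _≡_ _≡_ g
  g-injective gx≡gx′ = f-injective (Fin.punchOut-injective {i = y} _ _ gx≡gx′)

surjective⇒inverse : (f : Fin n → Fin n) → (∀ y → ∃ λ x → f x ≡ y) → ∃ λ g → IsInverse g f
surjective⇒inverse {n} f f-surjective = g , λ x → g∘f x , f∘g x
  where
  g : Fin n → Fin n
  g y = proj₁ (f-surjective y)
  f∘g : ∀ y → f (g y) ≡ y
  f∘g y = proj₂ (f-surjective y)
  g-injective : Injective _≡_ _≡_ g
  g-injective {y} {y′} gy≡gy′ = trans (sym (f∘g y)) (trans (cong f gy≡gy′) (f∘g y′))
  g∘f : ∀ x → g (f x) ≡ x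
  g∘f x with injective⇒surjective g g-injective x
  ... | y , refl = cong g (f∘g y)

surjective⇒AntiReflection : (σ : Fin n → Fin n) → (∀ y → ∃ λ x → σ x ≡ y) → ∃ (AntiReflection σ)
surjective⇒AntiReflection σ σ-surjective with surjective⇒inverse (rev σ) rev-σ-surjective
  where
  rev-σ-surjective : ∀ y → ∃ λ x → rev σ x ≡ y
  rev-σ-surjective y with σ-surjective y
  ... | x , σx≡y = opposite x , trans (cong σ (Fin.opposite-involutive x)) σx≡y
... | μ , μ-inverse = rev μ , inverse⇒AntiReflection μ-inverse (λ _ → refl)

rev-injective : {π : Fin n → Fin n} → Injective _≡_ _≡_ π → Injective _≡_ _≡_ (rev π)
rev-injective π-injective {x} {y} πx̅≡πy̅ = trans (sym (Fin.opposite-involutive x))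
  (trans (cong opposite (π-injective πx̅≡πy̅)) (Fin.opposite-involutive y))

permMatrix-1 : {σ : Fin n → Fin n} {p q : Fin n} → σ p ≡ q → permMatrix σ ⟨ p , q ⟩ ≡ 1ℤ
permMatrix-1 {σ = σ} {p} {q} σp≡q with (permMatrix σ ⟨ p , q ⟩ ≡ _) ∋ lookup-tabulate² _ p q
... | entry-pq with σ p ≟ q
... | yes _    = entry-pq
... | no σp≢q  = contradiction σp≡q σp≢q

permMatrix-0 : {σ : Fin n → Fin n} {p q : Fin n} → σ p ≢ q → permMatrix σ ⟨ p , q ⟩ ≡ 0ℤ
permMatrix-0 {σ = σ} {p} {q} σp≢q with (permMatrix σ ⟨ p , q ⟩ ≡ _) ∋ lookup-tabulate² _ p q
... | entry-pq with σ p ≟ q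
... | yes σp≡q = contradiction σp≡q σp≢q
... | no _     = entry-pq

permMatrix-cong : {σ τ : Fin n → Fin n} {p q p′ q′ : Fin n} → (σ p ≡ q) ⇔ (τ p′ ≡ q′) →
                  permMatrix σ ⟨ p , q ⟩ ≡ permMatrix τ ⟨ p′ , q′ ⟩
permMatrix-cong {σ = σ} {p = p} {q} σp≡q⇔τp′≡q′ with σ p ≟ q
... | yes σp≡q = trans (permMatrix-1 σp≡q) (sym (permMatrix-1 (to σp≡q⇔τp′≡q′ σp≡q)))
... | no σp≢q  = trans (permMatrix-0 σp≢q) (sym (permMatrix-0 (σp≢q ∘ from σp≡q⇔τp′≡q′)))

permMatrix-antiTranspose : {σ σ̂ : Fin n → Fin n} → AntiReflection σ σ̂ →
                           AntiTranspose (permMatrix σ) (permMatrix σ̂)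
permMatrix-antiTranspose R = antiTransposed λ p q → permMatrix-cong (graph R p q)

monotone-reflects-< : ∀ {k} (ι : Fin k → Fin n) → (∀ a b → a < b → ι a < ι b) →
                      ∀ a b → ι a < ι b → a < b
monotone-reflects-< ι ι-monotone a b ιa<ιb with Fin.<-cmp a b
... | tri< a<b _ _  = a<b
... | tri≈ _ refl _ = contradiction ιa<ιb (Fin.<-irrefl refl)
... | tri> _ _ b<a  = contradiction (ι-monotone b a b<a) (Fin.<-asym ιa<ιb)

Contains-AntiReflection : ∀ {k} {σ σ̂ : Fin n → Fin n} {π π̂ : Fin k → Fin k} →
                          AntiReflection σ σ̂ → AntiReflection π π̂ → Contains σ π → Contains σ̂ π̂
Contains-AntiReflection {n} {k} {σ} {σ̂} {π} {π̂} Rσ Rπ (ι , ι-monotone , ι-pattern) =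
  ι̂ , ι̂-monotone , λ b c → mk⇔ (preserves b c) (reflects b c)
  where
  -- point b of π̂ is the reflection of point (a b) of π
  a : Fin k → Fin k
  a b = opposite (π̂ b)
  π∘a : ∀ b → π (a b) ≡ opposite b
  π∘a b = to (graph Rπ b (π̂ b)) refl
  ι̂ : Fin k → Fin n
  ι̂ b = opposite (σ (ι (a b)))
  σ̂∘ι̂ : ∀ b → σ̂ (ι̂ b) ≡ opposite (ι (a b))
  σ̂∘ι̂ b = from (graph Rσ (ι̂ b) (opposite (ι (a b))))
    (trans (cong σ (Fin.opposite-involutive _)) (sym (Fin.opposite-involutive _)))
  ι̂-monotone : ∀ b c → b < c → ι̂ b < ι̂ c
  ι̂-monotone b c b<c = opposite-< (from (ι-pattern (a c) (a b))
    (subst₂ _<_ (sym (π∘a c)) (sym (π∘a b)) (opposite-< b<c)))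
  preserves : ∀ b c → σ̂ (ι̂ b) < σ̂ (ι̂ c) → π̂ b < π̂ c
  preserves b c h = opposite-<-reflect (monotone-reflects-< ι ι-monotone (a c) (a b)
    (opposite-<-reflect (subst₂ _<_ (σ̂∘ι̂ b) (σ̂∘ι̂ c) h)))
  reflects : ∀ b c → π̂ b < π̂ c → σ̂ (ι̂ b) < σ̂ (ι̂ c)
  reflects b c h = subst₂ _<_ (sym (σ̂∘ι̂ b)) (sym (σ̂∘ι̂ c))
    (opposite-< (ι-monotone (a c) (a b) (opposite-< h)))

avoids-AntiReflection : ∀ {k} {σ σ̂ : Fin n → Fin n} {π π̂ : Fin k → Fin k} →
                        AntiReflection σ σ̂ → AntiReflection π π̂ → ¬ Contains σ π → ¬ Contains σ̂ π̂
avoids-AntiReflection Rσ Rπ σ-avoids σ̂-contains =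
  σ-avoids (Contains-AntiReflection (AntiReflection-sym Rσ) (AntiReflection-sym Rπ) σ̂-contains)

-- Removal steps commute with the reflection

WSW-antiTranspose : {p q i j : Fin n} → WSW p q i j →
                    WSW (opposite q) (opposite p) (opposite j) (opposite i)
WSW-antiTranspose (i≤p , q≤j) = opposite-≤ q≤j , opposite-≤ i≤p

WSW-antiTranspose-swapʳ : {p q i j : Fin n} → WSW p q (opposite j) (opposite i) →
                          WSW (opposite q) (opposite p) i j
WSW-antiTranspose-swapʳ (j̅≤p , q≤i̅) = opposite-≤-swapʳ q≤i̅ , opposite-≤-swapˡ j̅≤p

WSW-antiTranspose-swapˡ : {p q i j : Fin n} → WSW (opposite q) (opposite p) i j →
                          WSW p q (opposite j) (opposite i)
WSW-antiTranspose-swapˡ (i≤q̅ , p̅≤j) = opposite-≤-swapˡ p̅≤j , opposite-≤-swapʳ i≤q̅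

module _ {A : Mat n} {i j : Fin n} where

  Neighbor-east⇒south : ∀ {p q p′ q′} → Neighbor A i j p q → Neighbor A i j p′ q′ → q < q′ → p < p′
  Neighbor-east⇒south {p} {p′ = p′} {q′} (_ , _ , nearest) (A≡1 , wsw , _) q<q′ with p′ Fin.≤? p
  ... | no p′≰p  = ℕ.≰⇒> p′≰p
  ... | yes p′≤p = contradiction (proj₂ (nearest p′ q′ A≡1 (p′≤p , ℕ.<⇒≤ q<q′) wsw))
                                 (Fin.<⇒≢ q<q′ ∘ sym)

  Neighbor-south⇒east : ∀ {p q p′ q′} → Neighbor A i j p q → Neighbor A i j p′ q′ → p < p′ → q < q′
  Neighbor-south⇒east {p} {q} {q′ = q′} (A≡1 , wsw , _) (_ , _ , nearest′) p<p′ with q′ Fin.≤? q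
  ... | no q′≰q  = ℕ.≰⇒> q′≰q
  ... | yes q′≤q = contradiction (proj₁ (nearest′ p q A≡1 (ℕ.<⇒≤ p<p′ , q′≤q) wsw)) (Fin.<⇒≢ p<p′)

  Neighbor-sameColumn : ∀ {p p′ q} → Neighbor A i j p q → Neighbor A i j p′ q → p ≡ p′
  Neighbor-sameColumn {p} {p′} N N′ with Fin.<-cmp p p′
  ... | tri< p<p′ _ _ = contradiction (Neighbor-south⇒east N N′ p<p′) (Fin.<-irrefl refl)
  ... | tri≈ _ p≡p′ _ = p≡p′
  ... | tri> _ _ p′<p = contradiction (Neighbor-south⇒east N′ N p′<p) (Fin.<-irrefl refl)

record RemovalSite (A : Mat n) (i j j₀ i₀ : Fin n) : Set where
  constructor removalSite
  field
    minusOne : A ⟨ i , j ⟩ ≡ -1ℤ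
    westOne  : WestOne A i j j₀
    southOne : SouthOne A i j i₀

Involved⇒Neighbor : {A : Mat n} {i j j₀ i₀ p q : Fin n} → RemovalSite A i j j₀ i₀ →
                    Involved A i j j₀ i₀ p q → Neighbor A i j p q
Involved⇒Neighbor {A = A} {i} {j} {j₀} (removalSite Aij≡-1 (j₀<j , Aij₀≡1 , no-one-west) _)
                  (inj₁ (refl , refl)) =
  Aij₀≡1 , (Fin.≤-refl , ℕ.<⇒≤ j₀<j) , λ p′ q′ A≡1 (p′≤i , j₀≤q′) (i≤p′ , q′≤j) →
    nearest (Fin.≤-antisym p′≤i i≤p′) A≡1 j₀≤q′ q′≤j
  where
  nearest : ∀ {p′ q′} → p′ ≡ i → A ⟨ p′ , q′ ⟩ ≡ 1ℤ → j₀ ≤ q′ → q′ ≤ j → p′ ≡ i × q′ ≡ j₀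
  nearest {q′ = q′} refl A≡1 j₀≤q′ q′≤j with ≤⇒<⊎≡ j₀≤q′ | ≤⇒<⊎≡ q′≤j
  ... | inj₂ j₀≡q′ | _         = refl , sym j₀≡q′
  ... | inj₁ j₀<q′ | inj₁ q′<j = contradiction A≡1 (no-one-west q′ j₀<q′ q′<j)
  ... | inj₁ _     | inj₂ refl = contradiction (trans (sym Aij≡-1) A≡1) -1≢1
Involved⇒Neighbor {A = A} {i} {j} {i₀ = i₀} (removalSite Aij≡-1 _ (i<i₀ , Ai₀j≡1 , no-one-south))
                  (inj₂ (inj₁ (refl , refl))) =
  Ai₀j≡1 , (ℕ.<⇒≤ i<i₀ , Fin.≤-refl) , λ p′ q′ A≡1 (p′≤i₀ , j≤q′) (i≤p′ , q′≤j) →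
    nearest (Fin.≤-antisym q′≤j j≤q′) A≡1 p′≤i₀ i≤p′
  where
  nearest : ∀ {p′ q′} → q′ ≡ j → A ⟨ p′ , q′ ⟩ ≡ 1ℤ → p′ ≤ i₀ → i ≤ p′ → p′ ≡ i₀ × q′ ≡ j
  nearest {p′ = p′} refl A≡1 p′≤i₀ i≤p′ with ≤⇒<⊎≡ p′≤i₀ | ≤⇒<⊎≡ i≤p′
  ... | inj₂ p′≡i₀ | _         = p′≡i₀ , refl
  ... | inj₁ p′<i₀ | inj₁ i<p′ = contradiction A≡1 (no-one-south p′ i<p′ p′<i₀)
  ... | inj₁ _     | inj₂ refl = contradiction (trans (sym Aij≡-1) A≡1) -1≢1
Involved⇒Neighbor _ (inj₂ (inj₂ (N , _))) = N

module _ {A A′ : Mat n} (h : AntiTranspose A A′) where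

  Removable-antiTranspose : ∀ {i j} → Removable A i j → Removable A′ (opposite j) (opposite i)
  Removable-antiTranspose {i} {j} (Aij≡-1 , no-other-minus) =
    trans (entry-opposite₂ h i j) Aij≡-1 ,
    λ P Q wsw ≢corner A′≡-1 → no-other-minus (opposite Q) (opposite P) (WSW-antiTranspose-swapʳ wsw)
      (λ (Q̅≡i , P̅≡j) → ≢corner (opposite-swap P̅≡j , opposite-swap Q̅≡i))
      (trans (sym (entry h P Q)) A′≡-1)

  SouthOne⇒WestOne : ∀ {i j i₀} → SouthOne A i j i₀ →
                     WestOne A′ (opposite j) (opposite i) (opposite i₀)
  SouthOne⇒WestOne {i} {j} {i₀} (i<i₀ , Ai₀j≡1 , no-one-between) =
    opposite-< i<i₀ , trans (entry-opposite₂ h i₀ j) Ai₀j≡1 ,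
    λ Q i̅₀<Q Q<i̅ A′≡1 → no-one-between (opposite Q) (opposite-<-swapʳ Q<i̅) (opposite-<-swapˡ i̅₀<Q)
      (trans (sym (entry-oppositeˡ h Q j)) A′≡1)

  WestOne⇒SouthOne : ∀ {i j j₀} → WestOne A i j j₀ →
                     SouthOne A′ (opposite j) (opposite i) (opposite j₀)
  WestOne⇒SouthOne {i} {j} {j₀} (j₀<j , Aij₀≡1 , no-one-between) =
    opposite-< j₀<j , trans (entry-opposite₂ h i j₀) Aij₀≡1 ,
    λ P j̅<P P<j̅₀ A′≡1 → no-one-between (opposite P) (opposite-<-swapʳ P<j̅₀) (opposite-<-swapˡ j̅<P)
      (trans (sym (entry-oppositeʳ h P i)) A′≡1)

  Neighbor-antiTranspose : ∀ {i j p q} → Neighbor A i j p q →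
                           Neighbor A′ (opposite j) (opposite i) (opposite q) (opposite p)
  Neighbor-antiTranspose {p = p} {q} (Apq≡1 , wsw , nearest) =
    trans (entry-opposite₂ h p q) Apq≡1 , WSW-antiTranspose wsw ,
    λ P Q A′≡1 wsw₁ wsw₂ →
      let (Q̅≡p , P̅≡q) = nearest (opposite Q) (opposite P) (trans (sym (entry h P Q)) A′≡1)
                          (WSW-antiTranspose-swapˡ wsw₁) (WSW-antiTranspose-swapʳ wsw₂)
      in opposite-swap P̅≡q , opposite-swap Q̅≡p

  Involved-antiTranspose : ∀ {i j j₀ i₀ p q} → Involved A i j j₀ i₀ p q →
    Involved A′ (opposite j) (opposite i) (opposite i₀) (opposite j₀) (opposite q) (opposite p)
  Involved-antiTranspose (inj₁ (p≡i , q≡j₀)) =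
    inj₂ (inj₁ (cong opposite q≡j₀ , cong opposite p≡i))
  Involved-antiTranspose (inj₂ (inj₁ (p≡i₀ , q≡j))) =
    inj₁ (cong opposite q≡j , cong opposite p≡i₀)
  Involved-antiTranspose (inj₂ (inj₂ (N , i≤p , p≤i₀ , j₀≤q , q≤j))) =
    inj₂ (inj₂ (Neighbor-antiTranspose N ,
                opposite-≤ q≤j , opposite-≤ j₀≤q , opposite-≤ p≤i₀ , opposite-≤ i≤p))

Involved-antiTranspose⁻¹ : {A A′ : Mat n} {i j j₀ i₀ P Q : Fin n} → AntiTranspose A A′ →
  Involved A′ (opposite j) (opposite i) (opposite i₀) (opposite j₀) P Q →
  Involved A i j j₀ i₀ (opposite Q) (opposite P)
Involved-antiTranspose⁻¹ {A = A} {P = P} {Q} h X =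
  cancel-opposite₄ (λ a b c d → Involved A a b c d (opposite Q) (opposite P))
    (Involved-antiTranspose (AntiTranspose-sym h) X)

-- for consecutive involved 1s (p₁ , q) and (p , q₂), the new 1 sits at (p , q): a rule
-- that is symmetric under the reflection
NewOne-antiTranspose : {A A′ : Mat n} {i j j₀ i₀ p q : Fin n} → AntiTranspose A A′ →
  RemovalSite A i j j₀ i₀ → NewOne A i j j₀ i₀ p q →
  NewOne A′ (opposite j) (opposite i) (opposite i₀) (opposite j₀) (opposite q) (opposite p)
NewOne-antiTranspose {A = A} {i = i} {j} {p = p} {q} h site
                     ((p₁ , X₁) , (q₂ , X₂ , q<q₂ , none-between)) =
  (opposite q₂ , Involved-antiTranspose h X₂) ,
  (opposite p₁ , Involved-antiTranspose h X₁ , opposite-< (Neighbor-east⇒south {A = A} N₁ N₂ q<q₂) ,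
   λ R C X (p̅<C , C<p̅₁) →
     let X′ = Involved-antiTranspose⁻¹ h X
         N  = Involved⇒Neighbor site X′
     in none-between (opposite C) (opposite R) X′
          (Neighbor-south⇒east {A = A} N₁ N (opposite-<-swapʳ C<p̅₁) ,
           Neighbor-south⇒east {A = A} N N₂ (opposite-<-swapˡ p̅<C)))
  where
  N₁ : Neighbor A i j p₁ q
  N₁ = Involved⇒Neighbor site X₁
  N₂ : Neighbor A i j p q₂
  N₂ = Involved⇒Neighbor site X₂

NewOne-antiTranspose⁻¹ : {A A′ : Mat n} {i j j₀ i₀ P Q : Fin n} → AntiTranspose A A′ →
  RemovalSite A′ (opposite j) (opposite i) (opposite i₀) (opposite j₀) →
  NewOne A′ (opposite j) (opposite i) (opposite i₀) (opposite j₀) P Q →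
  NewOne A i j j₀ i₀ (opposite Q) (opposite P)
NewOne-antiTranspose⁻¹ {A = A} {P = P} {Q} h site′ X =
  cancel-opposite₄ (λ a b c d → NewOne A a b c d (opposite Q) (opposite P))
    (NewOne-antiTranspose (AntiTranspose-sym h) site′ X)

StepOutcome : Mat n → (i j j₀ i₀ : Fin n) → Mat n → Set
StepOutcome A i j j₀ i₀ B = ∀ p q →
  (((p ≡ i × q ≡ j) ⊎ Involved A i j j₀ i₀ p q) → B ⟨ p , q ⟩ ≡ 0ℤ) ×
  (NewOne A i j j₀ i₀ p q → B ⟨ p , q ⟩ ≡ 1ℤ) ×
  (¬ ((p ≡ i × q ≡ j) ⊎ Involved A i j j₀ i₀ p q ⊎ NewOne A i j j₀ i₀ p q) →
     B ⟨ p , q ⟩ ≡ A ⟨ p , q ⟩)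

StepAt-antiTranspose : {A A′ B B′ : Mat n} {i j : Fin n} → AntiTranspose A A′ → AntiTranspose B B′ →
                       StepAt A i j B → StepAt A′ (opposite j) (opposite i) B′
StepAt-antiTranspose {A = A} {A′} {B′ = B′} {i} {j} h hB
                     (removable , j₀ , i₀ , west , south , outcome) =
  Removable-antiTranspose h removable , opposite i₀ , opposite j₀ , west′ , south′ , outcome′
  where
  west′ : WestOne A′ (opposite j) (opposite i) (opposite i₀)
  west′ = SouthOne⇒WestOne h south
  south′ : SouthOne A′ (opposite j) (opposite i) (opposite j₀)
  south′ = WestOne⇒SouthOne h west
  outcome′ : StepOutcome A′ (opposite j) (opposite i) (opposite i₀) (opposite j₀) B′
  outcome′ P Q = cleared , placed , unchanged
    where
    cleared : (P ≡ opposite j × Q ≡ opposite i) ⊎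
              Involved A′ (opposite j) (opposite i) (opposite i₀) (opposite j₀) P Q →
              B′ ⟨ P , Q ⟩ ≡ 0ℤ
    cleared (inj₁ (refl , refl)) = trans (entry hB P Q)
      (proj₁ (outcome _ _) (inj₁ (Fin.opposite-involutive i , Fin.opposite-involutive j)))
    cleared (inj₂ X) =
      trans (entry hB P Q) (proj₁ (outcome _ _) (inj₂ (Involved-antiTranspose⁻¹ h X)))
    placed : NewOne A′ (opposite j) (opposite i) (opposite i₀) (opposite j₀) P Q →
             B′ ⟨ P , Q ⟩ ≡ 1ℤ
    placed X = trans (entry hB P Q) (proj₁ (proj₂ (outcome _ _)) (NewOne-antiTranspose⁻¹ h
      (removalSite (proj₁ (Removable-antiTranspose h removable)) west′ south′) X))
    unchanged : ¬ ((P ≡ opposite j × Q ≡ opposite i) ⊎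
                   Involved A′ (opposite j) (opposite i) (opposite i₀) (opposite j₀) P Q ⊎
                   NewOne A′ (opposite j) (opposite i) (opposite i₀) (opposite j₀) P Q) →
                B′ ⟨ P , Q ⟩ ≡ A′ ⟨ P , Q ⟩
    unchanged untouched′ =
      trans (entry hB P Q) (trans (proj₂ (proj₂ (outcome _ _)) untouched) (sym (entry h P Q)))
      where
      untouched : ¬ ((opposite Q ≡ i × opposite P ≡ j) ⊎
                     Involved A i j j₀ i₀ (opposite Q) (opposite P) ⊎
                     NewOne A i j j₀ i₀ (opposite Q) (opposite P))
      untouched (inj₁ (Q̅≡i , P̅≡j)) = untouched′ (inj₁ (opposite-swap P̅≡j , opposite-swap Q̅≡i))
      untouched (inj₂ (inj₁ X)) = untouched′ (inj₂ (inj₁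
        (subst₂ (Involved A′ _ _ _ _) (Fin.opposite-involutive P) (Fin.opposite-involutive Q)
          (Involved-antiTranspose h X))))
      untouched (inj₂ (inj₂ X)) = untouched′ (inj₂ (inj₂
        (subst₂ (NewOne A′ _ _ _ _) (Fin.opposite-involutive P) (Fin.opposite-involutive Q)
          (NewOne-antiTranspose h (removalSite (proj₁ removable) west south) X))))

Step-antiTranspose : {A B : Mat n} → Step A B → Step (antiTranspose A) (antiTranspose B)
Step-antiTranspose {A = A} {B} (i , j , step) =
  opposite j , opposite i , StepAt-antiTranspose (antiTranspose-spec A) (antiTranspose-spec B) step

SWKey-antiTranspose : {A : Mat n} {σ σ̂ : Fin n → Fin n} → AntiReflection σ σ̂ →
                      SWKey A σ → SWKey (antiTranspose A) σ̂
SWKey-antiTranspose {σ = σ} R key =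
  subst (Star Step _)
    (AntiTranspose-unique (antiTranspose-spec (permMatrix σ)) (permMatrix-antiTranspose R))
    (gmap antiTranspose (λ {A} {B} → Step-antiTranspose {A = A} {B}) key)

-- Removal steps keep every column summing to 1

column : Mat n → Fin n → Fin n → ℤ
column A q p = A ⟨ p , q ⟩

SeparatedOnes : (Fin n → ℤ) → Set
SeparatedOnes u = ∀ r r′ → r < r′ → u r ≡ 1ℤ → u r′ ≡ 1ℤ → ∃ λ m → r < m × m < r′ × u m ≡ -1ℤ

-- the part of the column conditions of an ASM that survives removal steps
record IsWeakASMColumn (u : Fin n → ℤ) : Set where
  field
    entries   : ∀ p → IsEntry (u p)
    sum≡1     : sum u ≡ 1ℤ
    separated : SeparatedOnes u

HasWeakASMColumns : Mat n → Set
HasWeakASMColumns A = ∀ q → IsWeakASMColumn (column A q)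

1+x≡0⇒x≡-1 : ∀ {x} → IsEntry x → 1ℤ + x ≡ 0ℤ → x ≡ -1ℤ
1+x≡0⇒x≡-1 (inj₁ refl)        ()
1+x≡0⇒x≡-1 (inj₂ (inj₁ refl)) ()
1+x≡0⇒x≡-1 (inj₂ (inj₂ refl)) _ = refl

-- the first nonzero entry after a 1 is a -1, and it lies before the next 1
Alternates⇒SeparatedOnes : {u : Fin n → ℤ} → (∀ p → IsEntry (u p)) → Alternates u → SeparatedOnes u
Alternates⇒SeparatedOnes {u = u} entries alternates r r′ r<r′ ur≡1 ur′≡1
  with ∃-least (λ m → r < m × u m ≢ 0ℤ) (λ m → r <? m ×-dec ¬? (u m ℤ.≟ 0ℤ))
               r′ (r<r′ , 1≢0 ∘ trans (sym ur′≡1))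
... | m , (r<m , um≢0) , below-m = m , r<m , m<r′ , um≡-1
  where
  zero-between : ∀ x → r < x → x < m → u x ≡ 0ℤ
  zero-between x r<x x<m with u x ℤ.≟ 0ℤ
  ... | yes ux≡0 = ux≡0
  ... | no ux≢0  = contradiction (r<x , ux≢0) (below-m x x<m)
  um≡-1 : u m ≡ -1ℤ
  um≡-1 = 1+x≡0⇒x≡-1 (entries m) (trans (cong (_+ u m) (sym ur≡1))
            (alternates r m r<m (1≢0 ∘ trans (sym ur≡1)) um≢0 zero-between))
  m<r′ : m < r′
  m<r′ with Fin.<-cmp m r′
  ... | tri< m<r′ _ _ = m<r′
  ... | tri≈ _ refl _ = contradiction (trans (sym um≡-1) ur′≡1) -1≢1
  ... | tri> _ _ r′<m = contradiction (r<r′ , 1≢0 ∘ trans (sym ur′≡1)) (below-m r′ r′<m)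

IsASM⇒HasWeakASMColumns : {A : Mat n} → IsASM A → HasWeakASMColumns A
IsASM⇒HasWeakASMColumns {A = A} (entries , _ , columns , _ , columns-alternate) q = record
  { entries   = λ p → entries p q
  ; sum≡1     = trans (sym (sumℤ-tabulate (column A q))) (columns q)
  ; separated = Alternates⇒SeparatedOnes (λ p → entries p q) (columns-alternate q)
  }

module _ {u : Fin n → ℤ} (u-column : IsWeakASMColumn u) where
  open IsWeakASMColumn u-column

  no-one-below : ∀ {r} → u r ≡ 1ℤ → (∀ m → r < m → u m ≢ -1ℤ) → ∀ r′ → r < r′ → u r′ ≢ 1ℤ
  no-one-below ur≡1 no-minus-below r′ r<r′ ur′≡1 =
    let (m , r<m , _ , um≡-1) = separated _ r′ r<r′ ur≡1 ur′≡1 in no-minus-below m r<m um≡-1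

  entries-outside₂ : ∀ {a b} {w : Fin n → ℤ} → (∀ p → p ≢ a → p ≢ b → w p ≡ u p) →
                     IsEntry (w a) → IsEntry (w b) → ∀ p → IsEntry (w p)
  entries-outside₂ {a} {b} agree wa wb p with p ≟ a | p ≟ b
  ... | yes refl | _        = wa
  ... | no _     | yes refl = wb
  ... | no p≢a   | no p≢b   = subst IsEntry (sym (agree p p≢a p≢b)) (entries p)

  IsWeakASMColumn-cong : {w : Fin n → ℤ} → (∀ p → w p ≡ u p) → IsWeakASMColumn w
  IsWeakASMColumn-cong w≗u = record
    { entries   = λ p → subst IsEntry (sym (w≗u p)) (entries p)
    ; sum≡1     = trans (sum-cong-≗ w≗u) sum≡1
    ; separated = λ r r′ r<r′ wr≡1 wr′≡1 →
        let (m , r<m , m<r′ , um≡-1) =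
              separated r r′ r<r′ (trans (sym (w≗u r)) wr≡1) (trans (sym (w≗u r′)) wr′≡1)
        in m , r<m , m<r′ , trans (w≗u m) um≡-1
    }

  -- the column of the removed -1 at i: it and the nearest 1 below it, at i₀, become 0
  IsWeakASMColumn-clear : ∀ {i i₀} {w : Fin n → ℤ} → i < i₀ → u i ≡ -1ℤ → u i₀ ≡ 1ℤ →
    (∀ p → i < p → p < i₀ → u p ≢ 1ℤ) → (∀ m → i < m → u m ≢ -1ℤ) →
    w i ≡ 0ℤ → w i₀ ≡ 0ℤ → (∀ p → p ≢ i → p ≢ i₀ → w p ≡ u p) → IsWeakASMColumn w
  IsWeakASMColumn-clear {i} {i₀} {w} i<i₀ ui≡-1 ui₀≡1 no-one-between no-minus-below wi≡0 wi₀≡0 agree =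
    record
    { entries   = entries-outside₂ agree (inj₁ wi≡0) (inj₁ wi₀≡0)
    ; sum≡1     = trans (sum-cong-outside₂ (Fin.<⇒≢ i<i₀) agree
                    (trans (cong₂ _+_ wi≡0 wi₀≡0) (sym (cong₂ _+_ ui≡-1 ui₀≡1)))) sum≡1
    ; separated = w-separated
    }
    where
    one⇒≢i : ∀ {x} → w x ≡ 1ℤ → x ≢ i
    one⇒≢i wx≡1 refl = 1≢0 (trans (sym wx≡1) wi≡0)
    one⇒≢i₀ : ∀ {x} → w x ≡ 1ℤ → x ≢ i₀
    one⇒≢i₀ wx≡1 refl = 1≢0 (trans (sym wx≡1) wi₀≡0)
    one⇒one : ∀ {x} → w x ≡ 1ℤ → u x ≡ 1ℤ
    one⇒one wx≡1 = trans (sym (agree _ (one⇒≢i wx≡1) (one⇒≢i₀ wx≡1))) wx≡1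
    w-separated : SeparatedOnes w
    w-separated r r′ r<r′ wr≡1 wr′≡1
      with separated r r′ r<r′ (one⇒one wr≡1) (one⇒one wr′≡1)
    ... | m , r<m , m<r′ , um≡-1 with m ≟ i
    ...   | no m≢i = m , r<m , m<r′ ,
              trans (agree m m≢i λ { refl → -1≢1 (trans (sym um≡-1) ui₀≡1) }) um≡-1
    ...   | yes refl with Fin.<-cmp r′ i₀
    ...     | tri< r′<i₀ _ _ = contradiction (one⇒one wr′≡1) (no-one-between r′ m<r′ r′<i₀)
    ...     | tri≈ _ r′≡i₀ _ = contradiction r′≡i₀ (one⇒≢i₀ wr′≡1)
    ...     | tri> _ _ i₀<r′ = contradiction (one⇒one wr′≡1) (no-one-below ui₀≡1
              (λ m i₀<m → no-minus-below m (Fin.<-trans i<i₀ i₀<m)) r′ i₀<r′)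

  -- a column with an involved 1 at r: it slides down to the row s of the new 1
  IsWeakASMColumn-slide : ∀ {r s} {w : Fin n → ℤ} → r < s → u r ≡ 1ℤ → (∀ m → r < m → u m ≢ -1ℤ) →
    w r ≡ 0ℤ → w s ≡ 1ℤ → (∀ p → p ≢ r → p ≢ s → w p ≡ u p) → IsWeakASMColumn w
  IsWeakASMColumn-slide {r} {s} {w} r<s ur≡1 no-minus-below wr≡0 ws≡1 agree = record
    { entries   = entries-outside₂ agree (inj₁ wr≡0) (inj₂ (inj₁ ws≡1))
    ; sum≡1     = trans (sum-cong-outside₂ (Fin.<⇒≢ r<s) agree
                    (trans (cong₂ _+_ wr≡0 ws≡1) (sym (cong₂ _+_ ur≡1 us≡0)))) sum≡1
    ; separated = w-separated
    }
    where
    no-one-after-r : ∀ r′ → r < r′ → u r′ ≢ 1ℤ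
    no-one-after-r = no-one-below ur≡1 no-minus-below
    us≡0 : u s ≡ 0ℤ
    us≡0 with entries s
    ... | inj₁ us≡0         = us≡0
    ... | inj₂ (inj₁ us≡1)  = contradiction us≡1 (no-one-after-r s r<s)
    ... | inj₂ (inj₂ us≡-1) = contradiction us≡-1 (no-minus-below s r<s)
    one⇒≢r : ∀ {x} → w x ≡ 1ℤ → x ≢ r
    one⇒≢r wx≡1 refl = 1≢0 (trans (sym wx≡1) wr≡0)
    one⇒one : ∀ {x} → x ≢ s → w x ≡ 1ℤ → u x ≡ 1ℤ
    one⇒one x≢s wx≡1 = trans (sym (agree _ (one⇒≢r wx≡1) x≢s)) wx≡1
    minus⇒minus : ∀ {m} → m ≢ s → u m ≡ -1ℤ → w m ≡ -1ℤ
    minus⇒minus m≢s um≡-1 = trans (agree _ (λ { refl → -1≢1 (trans (sym um≡-1) ur≡1) }) m≢s) um≡-1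
    w-separated : SeparatedOnes w
    w-separated s₁ s₂ s₁<s₂ ws₁≡1 ws₂≡1 with s₁ ≟ s | s₂ ≟ s
    ... | yes refl | _ = contradiction (one⇒one (Fin.<⇒≢ s₁<s₂ ∘ sym) ws₂≡1)
                                       (no-one-after-r s₂ (Fin.<-trans r<s s₁<s₂))
    ... | no s₁≢s | no s₂≢s =
      let (m , s₁<m , m<s₂ , um≡-1) =
            separated s₁ s₂ s₁<s₂ (one⇒one s₁≢s ws₁≡1) (one⇒one s₂≢s ws₂≡1)
      in m , s₁<m , m<s₂ ,
         minus⇒minus (λ m≡s → -1≢0 (trans (sym um≡-1) (trans (cong u m≡s) us≡0))) um≡-1
    ... | no s₁≢s | yes refl with Fin.<-cmp s₁ r
    ...   | tri≈ _ s₁≡r _ = contradiction s₁≡r (one⇒≢r ws₁≡1)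
    ...   | tri> _ _ r<s₁ = contradiction (one⇒one s₁≢s ws₁≡1) (no-one-after-r s₁ r<s₁)
    ...   | tri< s₁<r _ _ =
      let (m , s₁<m , m<r , um≡-1) = separated s₁ r s₁<r (one⇒one s₁≢s ws₁≡1) ur≡1
      in m , s₁<m , Fin.<-trans m<r r<s , minus⇒minus (Fin.<⇒≢ (Fin.<-trans m<r r<s)) um≡-1

WSW? : (p q i j : Fin n) → Dec (WSW p q i j)
WSW? p q i j = i Fin.≤? p ×-dec q Fin.≤? j

Neighbor? : (A : Mat n) (i j p q : Fin n) → Dec (Neighbor A i j p q)
Neighbor? A i j p q = A ⟨ p , q ⟩ ℤ.≟ 1ℤ ×-dec WSW? p q i j ×-dec
  Fin.all? λ p′ → Fin.all? λ q′ →
    A ⟨ p′ , q′ ⟩ ℤ.≟ 1ℤ →-dec WSW? p q p′ q′ →-dec WSW? p′ q′ i j →-dec (p′ ≟ p ×-dec q′ ≟ q)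

Involved? : (A : Mat n) (i j j₀ i₀ p q : Fin n) → Dec (Involved A i j j₀ i₀ p q)
Involved? A i j j₀ i₀ p q = (p ≟ i ×-dec q ≟ j₀) ⊎-dec (p ≟ i₀ ×-dec q ≟ j) ⊎-dec
  (Neighbor? A i j p q ×-dec i Fin.≤? p ×-dec p Fin.≤? i₀ ×-dec j₀ Fin.≤? q ×-dec q Fin.≤? j)

module StepColumns {A B : Mat n} {i j j₀ i₀ : Fin n}
  (removable : Removable A i j) (west : WestOne A i j j₀) (south : SouthOne A i j i₀)
  (outcome : StepOutcome A i j j₀ i₀ B) where

  private
    Involved′ NewOne′ : Fin n → Fin n → Set
    Involved′ = Involved A i j j₀ i₀
    NewOne′ = NewOne A i j j₀ i₀

  neighbor : ∀ {p q} → Involved′ p q → Neighbor A i j p q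
  neighbor = Involved⇒Neighbor {A = A} (removalSite (proj₁ removable) west south)

  involved-below : ∀ {p q} → Involved′ p q → i ≤ p
  involved-below = proj₁ ∘ proj₁ ∘ proj₂ ∘ neighbor

  involved-left : ∀ {p q} → Involved′ p q → q ≤ j
  involved-left = proj₂ ∘ proj₁ ∘ proj₂ ∘ neighbor

  involved-j : Involved′ i₀ j
  involved-j = inj₂ (inj₁ (refl , refl))

  unchanged : ∀ {p q} → q ≢ j → ¬ Involved′ p q → ¬ NewOne′ p q → B ⟨ p , q ⟩ ≡ A ⟨ p , q ⟩
  unchanged q≢j ¬involved ¬new = proj₂ (proj₂ (outcome _ _))
    λ { (inj₁ (_ , q≡j)) → q≢j q≡j ; (inj₂ (inj₁ X)) → ¬involved X ; (inj₂ (inj₂ X)) → ¬new X }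

  no-minus-southwest : ∀ {m q} → i < m → q ≤ j → A ⟨ m , q ⟩ ≢ -1ℤ
  no-minus-southwest i<m q≤j = proj₂ removable _ _ (ℕ.<⇒≤ i<m , q≤j) (Fin.<⇒≢ i<m ∘ sym ∘ proj₁)

  column-j : IsWeakASMColumn (column A j) → IsWeakASMColumn (column B j)
  column-j A-column =
    let (i<i₀ , Ai₀j≡1 , no-one-between) = south
    in IsWeakASMColumn-clear A-column i<i₀ (proj₁ removable) Ai₀j≡1 no-one-between
         (λ m i<m → no-minus-southwest i<m Fin.≤-refl)
         (proj₁ (outcome i j) (inj₁ (refl , refl))) (proj₁ (outcome i₀ j) (inj₂ involved-j))
         λ p p≢i p≢i₀ → proj₂ (proj₂ (outcome p j)) λ
           { (inj₁ (p≡i , _)) → p≢i p≡i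
           ; (inj₂ (inj₁ X)) → p≢i₀ (Neighbor-sameColumn {A = A} (neighbor X) (neighbor involved-j))
           ; (inj₂ (inj₂ (_ , _ , X , j<q₂ , _))) → ℕ.<⇒≱ j<q₂ (involved-left X)
           }

  slideTarget : ∀ {r q} → q ≢ j → Involved′ r q →
                ∃ λ s → r < s × NewOne′ s q × (∀ {p} → NewOne′ p q → p ≡ s)
  slideTarget {r} {q} q≢j X
    with ∃-least (λ c → q < c × ∃ λ p → Involved′ p c)
                 (λ c → q <? c ×-dec Fin.any? (λ p → Involved? A i j j₀ i₀ p c))
                 j (Fin.≤∧≢⇒< (involved-left X) q≢j , i₀ , involved-j)
  ... | q₂ , (q<q₂ , s , X₂) , below-q₂ =
    s , Neighbor-east⇒south {A = A} (neighbor X) (neighbor X₂) q<q₂ ,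
    ((r , X) , q₂ , X₂ , q<q₂ , λ r′ c X′ (q<c , c<q₂) → below-q₂ c c<q₂ (q<c , r′ , X′)) ,
    unique
    where
    unique : ∀ {p} → NewOne′ p q → p ≡ s
    unique (_ , q₂′ , X₂′ , q<q₂′ , none-between) with Fin.<-cmp q₂′ q₂
    ... | tri< q₂′<q₂ _ _ = contradiction (q<q₂′ , _ , X₂′) (below-q₂ q₂′ q₂′<q₂)
    ... | tri≈ _ refl _   = Neighbor-sameColumn {A = A} (neighbor X₂′) (neighbor X₂)
    ... | tri> _ _ q₂<q₂′ = contradiction (q<q₂ , q₂<q₂′) (none-between s q₂ X₂)

  column-involved : ∀ {r q} → q ≢ j → Involved′ r q →
                    IsWeakASMColumn (column A q) → IsWeakASMColumn (column B q)
  column-involved {r} {q} q≢j X A-column with slideTarget q≢j X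
  ... | s , r<s , new , unique =
    IsWeakASMColumn-slide A-column r<s (proj₁ (neighbor X))
      (λ m r<m → no-minus-southwest (ℕ.≤-<-trans (involved-below X) r<m) (involved-left X))
      (proj₁ (outcome r q) (inj₂ X)) (proj₁ (proj₂ (outcome s q)) new)
      λ p p≢r p≢s → unchanged q≢j
        (λ X′ → p≢r (Neighbor-sameColumn {A = A} (neighbor X′) (neighbor X))) (p≢s ∘ unique)

  columns : HasWeakASMColumns A → HasWeakASMColumns B
  columns A-columns q with q ≟ j | Fin.any? (λ r → Involved? A i j j₀ i₀ r q)
  ... | yes refl | _            = column-j (A-columns j)
  ... | no q≢j   | yes (r , X)  = column-involved q≢j X (A-columns q)
  ... | no q≢j   | no ¬involved = IsWeakASMColumn-cong (A-columns q) λ p →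
    unchanged q≢j (λ X → ¬involved (p , X)) (λ (involved-in-q , _) → ¬involved involved-in-q)

Step-HasWeakASMColumns : {A B : Mat n} → Step A B → HasWeakASMColumns A → HasWeakASMColumns B
Step-HasWeakASMColumns {A = A} {B} (_ , _ , removable , _ , _ , west , south , outcome) =
  StepColumns.columns {A = A} {B} removable west south outcome

Steps-HasWeakASMColumns : {A B : Mat n} → Star Step A B → HasWeakASMColumns A → HasWeakASMColumns B
Steps-HasWeakASMColumns ε = λ A-columns → A-columns
Steps-HasWeakASMColumns {A = A} (_◅_ {j = B} step steps) =
  Steps-HasWeakASMColumns steps ∘ Step-HasWeakASMColumns {A = A} {B} step

SWKey-surjective : {A : Mat n} {σ : Fin n → Fin n} → IsASM A → SWKey A σ → ∀ q → ∃ λ p → σ p ≡ q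
SWKey-surjective {n} {A} {σ} asm key q with Fin.any? (λ p → σ p ≟ q)
... | yes found = found
... | no ¬found = contradiction (begin
    1ℤ                             ≡⟨ IsWeakASMColumn.sum≡1 (key-columns q) ⟨
    sum (column (permMatrix σ) q)  ≡⟨ sum-cong-≗ (λ p → permMatrix-0 (¬found ∘ (p ,_))) ⟩
    sum {n} (λ _ → 0ℤ)             ≡⟨ sum-replicate-zero n ⟩
    0ℤ                             ∎) 1≢0
  where
  open ≡-Reasoning
  key-columns : HasWeakASMColumns (permMatrix σ)
  key-columns = Steps-HasWeakASMColumns key (IsASM⇒HasWeakASMColumns {A = A} asm)

antiTranspose-AvKey : {P Q : (Fin n → Fin n) → Set} →
                      (∀ {σ σ̂} → AntiReflection σ σ̂ → P σ → Q σ̂) →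
                      ∀ A → AvKey P A → AvKey Q (antiTranspose A)
antiTranspose-AvKey P⇒Q A (asm , σ , key , Pσ) =
  let (σ̂ , R) = surjective⇒AntiReflection σ (SWKey-surjective {A = A} asm key)
  in IsASM-antiTranspose {A = A} asm , σ̂ , SWKey-antiTranspose R key , P⇒Q R Pσ

SameCard-antiTranspose : {P Q : (Fin n → Fin n) → Set} →
                         (∀ {σ σ̂} → AntiReflection σ σ̂ → P σ → Q σ̂) →
                         (∀ {σ σ̂} → AntiReflection σ σ̂ → Q σ → P σ̂) →
                         SameCard (AvKey P) (AvKey Q)
SameCard-antiTranspose P⇒Q Q⇒P =
  antiTranspose , antiTranspose , antiTranspose-AvKey P⇒Q , antiTranspose-AvKey Q⇒P ,
  (λ A _ → antiTranspose-involutive A) , (λ B _ → antiTranspose-involutive B)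

proposition2p7 :
    (∀ (k : ℕ) (π μ : Fin k → Fin k) → Injective _≡_ _≡_ π →
       IsInverse μ (rev π) → ∀ (n : ℕ) → n ≥ 1 →
       SameCard {n} (AvKey (λ σ → ¬ Contains σ π))
                    (AvKey (λ σ → ¬ Contains σ (rev μ))))
    ×
    (∀ (S : PermSet) → IsSetOfPerms S → ∀ (n : ℕ) →
       SameCard {n} (AvKey (λ σ → AvoidsAll σ S))
                    (AvKey (λ σ → AvoidsAll σ (transformSet S))))
proposition2p7 = single , family
  where
  single : ∀ k (π μ : Fin k → Fin k) → Injective _≡_ _≡_ π → IsInverse μ (rev π) → ∀ n → n ≥ 1 →
           SameCard {n} (AvKey (λ σ → ¬ Contains σ π)) (AvKey (λ σ → ¬ Contains σ (rev μ)))
  single k π μ _ μ-inverse n _ = SameCard-antiTranspose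
    (λ R → avoids-AntiReflection R Rπ) (λ R → avoids-AntiReflection R (AntiReflection-sym Rπ))
    where
    Rπ : AntiReflection π (rev μ)
    Rπ = inverse⇒AntiReflection μ-inverse (λ _ → refl)
  family : ∀ S → IsSetOfPerms S → ∀ n →
           SameCard {n} (AvKey (λ σ → AvoidsAll σ S)) (AvKey (λ σ → AvoidsAll σ (transformSet S)))
  family S perms n = SameCard-antiTranspose
    (λ R avoids k τ (π , π∈S , μ , μ-inverse , τ≗rev-μ) →
      avoids-AntiReflection R (inverse⇒AntiReflection μ-inverse τ≗rev-μ) (avoids k π π∈S))
    (λ R avoids k π π∈S →
      let (μ , μ-inverse) = surjective⇒inverse (rev π)
                              (injective⇒surjective (rev π) (rev-injective (perms k π π∈S)))
      in avoids-AntiReflection R (AntiReflection-sym (inverse⇒AntiReflection μ-inverse (λ _ → refl)))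
           (avoids k (rev μ) (π , π∈S , μ , μ-inverse , λ _ → refl)))
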